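{- There exists a context-free language $L\subseteq\{0,1\}^*$ that is $\mathrm{REG}/n$-pseudorandom.
   Context: Let $\Sigma=\{0,1\}$. A function $\mu:\mathbb{N}\to\mathbb{R}_{\ge0}$ is negligible if for every non-zero polynomial $p$, $\mu(n)\le1/p(n)$ for all sufficiently large $n$. For a family ${\cal C}$, a language $L$ over $\Sigma$ is ${\cal C}$-pseudorandom if for every language $A$ over $\Sigma$ in ${\cal C}$, the function $n\mapsto\left|\frac{|(L\triangle A)\cap\Sigma^n|}{|\Sigma^n|}-\frac12\right|$ is negligible, where $L\triangle A$ is the symmetric difference. $\mathrm{REG}/n$ is the family of languages $L$ over $\Sigma$ for which there exist an alphabet $\Gamma$, $h:\mathbb{N}\to\Gamma^*$ with $|h(n)|=n$, and a regular language $A$ over $\Sigma\times\Gamma$ with $x\in L$ iff $\left[\begin{smallmatrix}x\\ h(|x|)\end{smallmatrix}\right]\in A$ for all $x$, where $\left[\begin{smallmatrix}x_1\cdots x_n\\ y_1\cdots y_n\end{smallmatrix}\right]=(x_1,y_1)\cdots(x_n,y_n)$. -}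

module Defs where

open import Data.Bool using (Bool; true; false; _xor_)
open import Data.Nat as ℕ using (ℕ; zero; suc; _^_; _≥_)
open import Data.Nat.Properties using (m^n≢0)
open import Data.Integer using (+_)
open import Data.Rational using (ℚ; _/_; ∣_∣; _-_; _*_; _≤_; ½; 1ℚ)
open import Data.Fin using (Fin)
open import Data.List using (List; []; _∷_; _++_; map; concatMap; filter; length; zip)
open import Data.List.Relation.Unary.Any using (Any)
open import Data.List.Membership.Propositional using (_∈_)
open import Data.Vec using (Vec; toList)
open import Data.Product using (Σ; ∃; _×_; _,_)
open import Data.Sum using (_⊎_; inj₁; inj₂)
open import Relation.Binary.PropositionalEquality using (_≡_; _≢_)
open import Function using (_⇔_)

-- Σ = {0,1} is represented by Bool (false = 0, true = 1).
-- A language over an alphabet A is its characteristic function.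
Language : Set → Set
Language A = List A → Bool

words : ℕ → List (List Bool)
words zero    = [] ∷ []
words (suc n) = concatMap (λ w → (false ∷ w) ∷ (true ∷ w) ∷ []) (words n)

symDiffCount : Language Bool → Language Bool → ℕ → ℕ
symDiffCount L A n = length (filter (λ w → Data.Bool.T? (L w xor A w)) (words n))
  where import Data.Bool

bias : Language Bool → Language Bool → ℕ → ℚ
bias L A n = ∣ ((+ symDiffCount L A n) / (2 ^ n)) {{m^n≢0 2 n}} - ½ ∣

-- Non-zero polynomials (natural-number coefficients, constant term first)

record Poly : Set where
  constructor poly
  field
    coeffs  : List ℕ
    nonzero : Any (λ c → c ≢ 0) coeffs
open Poly public

evalCoeffs : List ℕ → ℕ → ℕ
evalCoeffs []       x = 0
evalCoeffs (c ∷ cs) x = c ℕ.+ x ℕ.* evalCoeffs cs x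

eval : Poly → ℕ → ℕ
eval p = evalCoeffs (coeffs p)

-- μ is negligible: for every non-zero polynomial p, μ(n) ≤ 1/p(n) for all
-- sufficiently large n. (Written as μ(n)·p(n) ≤ 1; p(n) > 0 for n ≥ 1.)
Negligible : (ℕ → ℚ) → Set
Negligible μ = (p : Poly) → ∃ λ N → (n : ℕ) → n ≥ N →
  μ n * ((+ eval p n) / 1) ≤ 1ℚ

Pseudorandom : (Language Bool → Set) → Language Bool → Set
Pseudorandom C L = (A : Language Bool) → C A → Negligible (bias L A)

record DFA (A : Set) : Set where
  field
    nStates : ℕ
    start   : Fin nStates
    step    : Fin nStates → A → Fin nStates
    final   : Fin nStates → Bool

run : ∀ {A} (D : DFA A) → Fin (DFA.nStates D) → List A → Fin (DFA.nStates D)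
run D q []       = q
run D q (a ∷ as) = run D (DFA.step D q a) as

accepts : ∀ {A} → DFA A → Language A
accepts D w = DFA.final D (run D (DFA.start D) w)

Regular : {A : Set} → Language A → Set
Regular {A} L = Σ (DFA A) λ D → (w : List A) → L w ≡ accepts D w

-- REG/n: Γ is a finite alphabet Fin k, h n ∈ Γ^n, A regular over Σ × Γ,
-- x ∈ L iff [x ; h(|x|)] ∈ A.

REG/n : Language Bool → Set
REG/n L = Σ ℕ λ k → Σ ((n : ℕ) → Vec (Fin k) n) λ h →
  Σ (Language (Bool × Fin k)) λ A → Regular A ×
    ((x : List Bool) → L x ≡ A (zip x (toList (h (length x)))))

record CFG : Set where
  field
    nNonterminals : ℕ
    start         : Fin nNonterminals
    productions   : List (Fin nNonterminals × List (Fin nNonterminals ⊎ Bool))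

module _ (G : CFG) where
  open CFG G

  mutual
    data Derives : Fin nNonterminals → List Bool → Set where
      rule : ∀ {X rhs w} → (X , rhs) ∈ productions → DerivesSeq rhs w → Derives X w

    data DerivesSeq : List (Fin nNonterminals ⊎ Bool) → List Bool → Set where
      []  : DerivesSeq [] []
      ter : ∀ {b α w} → DerivesSeq α w → DerivesSeq (inj₂ b ∷ α) (b ∷ w)
      nt  : ∀ {Y α u v} → Derives Y u → DerivesSeq α v → DerivesSeq (inj₁ Y ∷ α) (u ++ v)

Generates : CFG → List Bool → Set
Generates G w = Derives G (CFG.start G) w

ContextFree : Language Bool → Set
ContextFree L = Σ CFG λ G → (w : List Bool) → (L w ≡ true) ⇔ Generates G w

-- A word w of length n is in foldedIP iff ∑_{i ≤ ⌊n/2⌋} wᵢ w_{n+1−i} is odd: the inner product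
-- of its first half with its reversed second half.  The grammar S_q → a S_p b (q = p ⊕ ab),
-- S_0 → ε | 0 | 1 generates it.
--
-- Let A be in REG/n, recognised by an N-state automaton reading the advice alongside the input.
-- Write a word of length n as x c y with |x| = |y| = m = ⌊n/2⌋ and |c| ≤ 1.  The state s after
-- reading x determines A on c y, so the correlation E = ∑_w (−1)^(L(w) ⊕ A(w)) splits into N sums
-- ∑_x [state x = s] ĝ_s(x), where ĝ_s is the Fourier transform (over y) of a function g_s bounded
-- by 2^|c|.  Cauchy–Schwarz and Parseval bound each by 2^(3m/2) 2^|c|, whence 2^m E² ≤ (N 2^n)²:
-- the bias |E| / 2^(n+1) is O(2^(−n/4)), smaller than any inverse polynomial.

module Submission where

open import Defs
open import Data.Bool using (Bool; true; false; _xor_; _∧_; not; T?)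
open import Data.Fin using (Fin; zero; suc)
open import Data.List
  using (List; []; _∷_; _++_; _∷ʳ_; [_]; map; concatMap; filter; length; reverse; take; drop; zip; allFin; cartesianProduct)
open import Data.List.Properties
  using (length-++; length-take; length-reverse; length-tabulate; reverse-++; unfold-reverse; map-tabulate)
open import Data.List.Membership.Propositional using (_∈_)
open import Data.List.Membership.Propositional.Properties using (∈-map⁺; ∈-map⁻; ∈-cartesianProduct⁺)
open import Data.List.Relation.Unary.Any using (here; there)
open import Data.List.Reverse using (reverseView; []; _∶_∶ʳ_)
open import Data.Nat.ListAction using (sum)
open import Data.Product using (Σ; ∃; _×_; _,_; proj₁; proj₂)
open import Data.Sum using (_⊎_; inj₁; inj₂)
open import Function using (id; _∘_; mk⇔)
open import Relation.Binary.PropositionalEquality hiding ([_])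

module _ where

  open import Data.Nat using (suc)
  open import Data.Integer using (ℤ; +_; _+_; _*_; _≤_)
  open import Data.Integer.Properties
  open import Data.Integer.Tactic.RingSolver using (solve-∀)

  ∑ : {A : Set} → List A → (A → ℤ) → ℤ
  ∑ []       f = + 0
  ∑ (x ∷ xs) f = f x + ∑ xs f

  infixr 5 ∑
  syntax ∑ xs (λ x → e) = ∑[ x ∈ xs ] e

  module _ {A : Set} where

    ∑-cong : ∀ (xs : List A) {f g : A → ℤ} → (∀ x → f x ≡ g x) → ∑ xs f ≡ ∑ xs g
    ∑-cong []       f≡g = refl
    ∑-cong (x ∷ xs) f≡g = cong₂ _+_ (f≡g x) (∑-cong xs f≡g)

    ∑-zero : ∀ (xs : List A) → ∑[ x ∈ xs ] + 0 ≡ + 0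
    ∑-zero []       = refl
    ∑-zero (x ∷ xs) = trans (+-identityˡ _) (∑-zero xs)

    ∑-distrib-+ : ∀ (xs : List A) (f g : A → ℤ) → ∑[ x ∈ xs ] (f x + g x) ≡ ∑ xs f + ∑ xs g
    ∑-distrib-+ []       f g = refl
    ∑-distrib-+ (x ∷ xs) f g = trans (cong (_+_ (f x + g x)) (∑-distrib-+ xs f g))
                                     (interchange (f x) (g x) (∑ xs f) (∑ xs g))
      where
      interchange : ∀ a b c d → (a + b) + (c + d) ≡ (a + c) + (b + d)
      interchange = solve-∀

    ∑-distribˡ-* : ∀ (xs : List A) (c : ℤ) (f : A → ℤ) → ∑[ x ∈ xs ] (c * f x) ≡ c * ∑ xs f
    ∑-distribˡ-* []       c f = sym (*-zeroʳ c)
    ∑-distribˡ-* (x ∷ xs) c f = trans (cong (_+_ (c * f x)) (∑-distribˡ-* xs c f))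
                                      (sym (*-distribˡ-+ c (f x) (∑ xs f)))

    ∑-distribʳ-* : ∀ (xs : List A) (c : ℤ) (f : A → ℤ) → ∑[ x ∈ xs ] (f x * c) ≡ ∑ xs f * c
    ∑-distribʳ-* xs c f = trans (∑-cong xs (λ x → *-comm (f x) c))
                                (trans (∑-distribˡ-* xs c f) (*-comm c (∑ xs f)))

    ∑-const : ∀ (xs : List A) (c : ℤ) → ∑[ x ∈ xs ] c ≡ + length xs * c
    ∑-const []       c = sym (*-zeroˡ c)
    ∑-const (x ∷ xs) c = begin
      c + (∑[ x ∈ xs ] c)        ≡⟨ cong (_+_ c) (∑-const xs c) ⟩
      c + + length xs * c        ≡⟨ sym (suc-* (+ length xs) c) ⟩
      + suc (length xs) * c      ∎
      where open ≡-Reasoning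

    ∑-mono-≤ : ∀ (xs : List A) {f g : A → ℤ} → (∀ x → f x ≤ g x) → ∑ xs f ≤ ∑ xs g
    ∑-mono-≤ []       f≤g = ≤-refl
    ∑-mono-≤ (x ∷ xs) f≤g = +-mono-≤ (f≤g x) (∑-mono-≤ xs f≤g)

    ∑-++ : ∀ (xs ys : List A) (f : A → ℤ) → ∑ (xs ++ ys) f ≡ ∑ xs f + ∑ ys f
    ∑-++ []       ys f = sym (+-identityˡ (∑ ys f))
    ∑-++ (x ∷ xs) ys f = trans (cong (_+_ (f x)) (∑-++ xs ys f)) (sym (+-assoc (f x) _ _))

  ∑-map : ∀ {A B : Set} (xs : List A) (g : A → B) (f : B → ℤ) → ∑ (map g xs) f ≡ ∑[ x ∈ xs ] f (g x)
  ∑-map []       g f = refl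
  ∑-map (x ∷ xs) g f = cong (_+_ (f (g x))) (∑-map xs g f)

  ∑-concatMap : ∀ {A B : Set} (xs : List A) (g : A → List B) (f : B → ℤ) →
                ∑ (concatMap g xs) f ≡ ∑[ x ∈ xs ] ∑ (g x) f
  ∑-concatMap []       g f = refl
  ∑-concatMap (x ∷ xs) g f = trans (∑-++ (g x) (concatMap g xs) f) (cong (_+_ (∑ (g x) f)) (∑-concatMap xs g f))

  ∑-comm : ∀ {A B : Set} (xs : List A) (ys : List B) (f : A → B → ℤ) →
           ∑[ x ∈ xs ] ∑[ y ∈ ys ] f x y ≡ ∑[ y ∈ ys ] ∑[ x ∈ xs ] f x y
  ∑-comm []       ys f = sym (∑-zero ys)
  ∑-comm (x ∷ xs) ys f = trans (cong (_+_ (∑ ys (f x))) (∑-comm xs ys f))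
                               (sym (∑-distrib-+ ys (f x) (λ y → ∑[ x ∈ xs ] f x y)))

  ∑-≤-const : ∀ {A : Set} (xs : List A) {f : A → ℤ} c → (∀ x → f x ≤ c) → ∑ xs f ≤ + length xs * c
  ∑-≤-const xs c f≤c = subst (∑ xs _ ≤_) (∑-const xs c) (∑-mono-≤ xs f≤c)

module _ where

  open import Data.Nat as ℕ using (ℕ; zero; suc; _^_)
  import Data.Nat.Properties as ℕₚ
  open import Data.Integer using (ℤ; +_; -_; _+_; _*_)
  open import Data.Integer.Properties
  open import Data.Integer.Tactic.RingSolver using (solve-∀)

  length-words : ∀ n → length (words n) ≡ 2 ^ n
  length-words zero    = refl
  length-words (suc n) = trans (length-pairs (words n)) (cong (2 ℕ.*_) (length-words n))
    where
    length-pairs : ∀ ws → length (concatMap (λ w → (false ∷ w) ∷ (true ∷ w) ∷ []) ws) ≡ 2 ℕ.* length ws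
    length-pairs []       = refl
    length-pairs (w ∷ ws) = trans (cong (2 ℕ.+_) (length-pairs ws)) (sym (ℕₚ.*-suc 2 (length ws)))

  ∑-words-suc : ∀ n (f : List Bool → ℤ) →
                ∑ (words (suc n)) f ≡ ∑[ w ∈ words n ] (f (false ∷ w) + f (true ∷ w))
  ∑-words-suc n f = trans (∑-concatMap (words n) _ f)
    (∑-cong (words n) (λ w → cong (_+_ (f (false ∷ w))) (+-identityʳ (f (true ∷ w)))))

  ∑-words-cong : ∀ n {f g : List Bool → ℤ} → (∀ w → length w ≡ n → f w ≡ g w) →
                 ∑ (words n) f ≡ ∑ (words n) g
  ∑-words-cong zero    f≡g = cong (_+ + 0) (f≡g [] refl)
  ∑-words-cong (suc n) {f} {g} f≡g = begin
    ∑ (words (suc n)) f                             ≡⟨ ∑-words-suc n f ⟩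
    ∑[ w ∈ words n ] (f (false ∷ w) + f (true ∷ w)) ≡⟨ ∑-words-cong n (λ w ∣w∣≡n →
                                                         cong₂ _+_ (f≡g _ (cong suc ∣w∣≡n)) (f≡g _ (cong suc ∣w∣≡n))) ⟩
    ∑[ w ∈ words n ] (g (false ∷ w) + g (true ∷ w)) ≡⟨ ∑-words-suc n g ⟨
    ∑ (words (suc n)) g                             ∎
    where open ≡-Reasoning

  ∑-words-++ : ∀ a b (f : List Bool → ℤ) →
               ∑ (words (a ℕ.+ b)) f ≡ ∑[ x ∈ words a ] ∑[ z ∈ words b ] f (x ++ z)
  ∑-words-++ zero    b f = sym (+-identityʳ _)
  ∑-words-++ (suc a) b f = begin
    ∑ (words (suc a ℕ.+ b)) f
      ≡⟨ ∑-words-suc (a ℕ.+ b) f ⟩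
    ∑[ w ∈ words (a ℕ.+ b) ] (f (false ∷ w) + f (true ∷ w))
      ≡⟨ ∑-words-++ a b _ ⟩
    ∑[ x ∈ words a ] ∑[ z ∈ words b ] (f (false ∷ x ++ z) + f (true ∷ x ++ z))
      ≡⟨ ∑-cong (words a) (λ x → ∑-distrib-+ (words b) (λ z → f (false ∷ x ++ z)) (λ z → f (true ∷ x ++ z))) ⟩
    ∑[ x ∈ words a ] ((∑[ z ∈ words b ] f (false ∷ x ++ z)) + (∑[ z ∈ words b ] f (true ∷ x ++ z)))
      ≡⟨ ∑-words-suc a (λ x → ∑[ z ∈ words b ] f (x ++ z)) ⟨
    ∑[ x ∈ words (suc a) ] ∑[ z ∈ words b ] f (x ++ z)
      ∎
    where open ≡-Reasoning

  ∑-words-∷ʳ : ∀ n (f : List Bool → ℤ) →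
               ∑ (words (suc n)) f ≡ ∑[ y ∈ words n ] (f (y ∷ʳ false) + f (y ∷ʳ true))
  ∑-words-∷ʳ n f = begin
    ∑ (words (suc n)) f                          ≡⟨ cong (λ k → ∑ (words k) f) (ℕₚ.+-comm 1 n) ⟩
    ∑ (words (n ℕ.+ 1)) f                        ≡⟨ ∑-words-++ n 1 f ⟩
    ∑[ y ∈ words n ] (f (y ∷ʳ false) + (f (y ∷ʳ true) + + 0))
      ≡⟨ ∑-cong (words n) (λ y → cong (_+_ (f (y ∷ʳ false))) (+-identityʳ _)) ⟩
    ∑[ y ∈ words n ] (f (y ∷ʳ false) + f (y ∷ʳ true)) ∎
    where open ≡-Reasoning

  sign : Bool → ℤ
  sign false = + 1
  sign true  = - + 1

  sign-xor : ∀ a b → sign (a xor b) ≡ sign a * sign b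
  sign-xor false false = refl
  sign-xor false true  = refl
  sign-xor true  false = refl
  sign-xor true  true  = refl

  sign-not : ∀ a → sign (not a) ≡ - sign a
  sign-not false = refl
  sign-not true  = refl

  sign*sign≡1 : ∀ a → sign a * sign a ≡ + 1
  sign*sign≡1 false = refl
  sign*sign≡1 true  = refl

  ∑-sign : ∀ {A : Set} (xs : List A) (P : A → Bool) →
           (∑[ x ∈ xs ] sign (P x)) + + 2 * + length (filter (T? ∘ P) xs) ≡ + length xs
  ∑-sign []       P = refl
  ∑-sign (x ∷ xs) P with P x
  ... | true  = trans (shift (∑[ x ∈ xs ] sign (P x)) (+ length (filter (T? ∘ P) xs)))
                      (trans (cong (_+_ (+ 1)) (∑-sign xs P)) (sym (pos-+ 1 (length xs))))
    where
    shift : ∀ s c → (- + 1 + s) + + 2 * (+ 1 + c) ≡ + 1 + (s + + 2 * c)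
    shift = solve-∀
  ... | false = trans (+-assoc (+ 1) (∑[ x ∈ xs ] sign (P x)) (+ 2 * + length (filter (T? ∘ P) xs)))
                      (trans (cong (_+_ (+ 1)) (∑-sign xs P)) (sym (pos-+ 1 (length xs))))

  ∑-words-one : ∀ n → ∑[ w ∈ words n ] + 1 ≡ + (2 ^ n)
  ∑-words-one n = trans (∑-const (words n) (+ 1)) (trans (*-identityʳ _) (cong +_ (length-words n)))

module _ where

  open import Data.Nat as ℕ using (z≤n)
  open import Data.Integer using (ℤ; +_; -[1+_]; _+_; _-_; _*_; _≤_; +≤+; ∣_∣)
  open import Data.Integer.Properties
  open import Data.Integer.Tactic.RingSolver using (solve-∀)

  square-nonNeg : ∀ a → + 0 ≤ a * a
  square-nonNeg (+ n)    = subst (+ 0 ≤_) (pos-* n n) (+≤+ z≤n)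
  square-nonNeg -[1+ n ] = +≤+ z≤n

  i≤i+nonNeg : ∀ i {j} → + 0 ≤ j → i ≤ i + j
  i≤i+nonNeg i 0≤j = subst (_≤ i + _) (+-identityʳ i) (+-monoʳ-≤ i 0≤j)

  module _ {A : Set} where

    ∑-nonNeg : ∀ (xs : List A) {f : A → ℤ} → (∀ x → + 0 ≤ f x) → + 0 ≤ ∑ xs f
    ∑-nonNeg []       0≤f = ≤-refl
    ∑-nonNeg (x ∷ xs) 0≤f = +-mono-≤ (0≤f x) (∑-nonNeg xs 0≤f)

    ∑-square-expand : ∀ (xs : List A) (a b : A → ℤ) (s t : ℤ) →
      ∑[ j ∈ xs ] ((s * b j - t * a j) * (s * b j - t * a j)) ≡
      s * s * (∑[ j ∈ xs ] b j * b j) + t * t * (∑[ j ∈ xs ] a j * a j) - + 2 * s * t * (∑[ j ∈ xs ] a j * b j)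
    ∑-square-expand []       a b s t = expand-nil s t
      where
      expand-nil : ∀ s t → + 0 ≡ s * s * + 0 + t * t * + 0 - + 2 * s * t * + 0
      expand-nil = solve-∀
    ∑-square-expand (i ∷ xs) a b s t =
      trans (cong (_+_ ((s * b i - t * a i) * (s * b i - t * a i))) (∑-square-expand xs a b s t))
            (expand-cons s t (a i) (b i) _ _ _)
      where
      expand-cons : ∀ s t p q B A C →
        (s * q - t * p) * (s * q - t * p) + (s * s * B + t * t * A - + 2 * s * t * C) ≡
        s * s * (q * q + B) + t * t * (p * p + A) - + 2 * s * t * (p * q + C)
      expand-cons = solve-∀

    -- A new head term increases the defect by the nonnegative ∑ⱼ (aᵢ bⱼ − bᵢ aⱼ)².
    cauchy-schwarz : ∀ (xs : List A) (a b : A → ℤ) →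
      (∑[ i ∈ xs ] a i * b i) * (∑[ i ∈ xs ] a i * b i) ≤ (∑[ i ∈ xs ] a i * a i) * (∑[ i ∈ xs ] b i * b i)
    cauchy-schwarz []       a b = ≤-refl
    cauchy-schwarz (i ∷ xs) a b = begin
      (x * y + C) * (x * y + C)
        ≤⟨ i≤i+nonNeg _ (+-mono-≤ (i≤j⇒0≤j-i (cauchy-schwarz xs a b))
                                  (∑-nonNeg xs (λ j → square-nonNeg (x * b j - y * a j)))) ⟩
      (x * y + C) * (x * y + C) + ((A′ * B - C * C) + S)
        ≡⟨ cong (λ T → (x * y + C) * (x * y + C) + ((A′ * B - C * C) + T)) (∑-square-expand xs a b x y) ⟩
      (x * y + C) * (x * y + C) + ((A′ * B - C * C) + (x * x * B + y * y * A′ - + 2 * x * y * C))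
        ≡⟨ lagrange x y A′ B C ⟩
      (x * x + A′) * (y * y + B)
        ∎
      where
      open ≤-Reasoning
      x = a i
      y = b i
      A′ = ∑[ j ∈ xs ] a j * a j
      B  = ∑[ j ∈ xs ] b j * b j
      C  = ∑[ j ∈ xs ] a j * b j
      S  = ∑[ j ∈ xs ] ((x * b j - y * a j) * (x * b j - y * a j))
      lagrange : ∀ x y A B C →
        (x * y + C) * (x * y + C) + ((A * B - C * C) + (x * x * B + y * y * A - + 2 * x * y * C)) ≡
        (x * x + A) * (y * y + B)
      lagrange = solve-∀

    ∑-square-≤ : ∀ (xs : List A) (f : A → ℤ) →
      (∑ xs f) * (∑ xs f) ≤ + length xs * (∑[ x ∈ xs ] f x * f x)
    ∑-square-≤ xs f = subst₂ _≤_ (cong₂ _*_ ones-f ones-f) (cong (_* (∑[ x ∈ xs ] f x * f x)) ones-ones)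
                                 (cauchy-schwarz xs (λ _ → + 1) f)
      where
      ones-f : ∑[ x ∈ xs ] + 1 * f x ≡ ∑ xs f
      ones-f = ∑-cong xs (λ x → *-identityˡ (f x))
      ones-ones : ∑[ x ∈ xs ] + 1 * + 1 ≡ + length xs
      ones-ones = trans (∑-const xs (+ 1)) (*-identityʳ _)

  +[∣i∣*∣i∣]≡i*i : ∀ i → + (∣ i ∣ ℕ.* ∣ i ∣) ≡ i * i
  +[∣i∣*∣i∣]≡i*i i = trans (cong +_ (sym (abs-* i i))) (0≤i⇒+∣i∣≡i (square-nonNeg i))

-- The Fourier transform on words and Parseval's identity

module _ where

  open import Data.Nat as ℕ using (ℕ; zero; suc; _^_)
  import Data.Nat.Properties as ℕₚ
  open import Data.Integer using (ℤ; +_; -_; _+_; _-_; _*_)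
  open import Data.Integer.Properties
  open import Data.Integer.Tactic.RingSolver using (solve-∀)

  -- Stops at the end of the shorter list.
  innerProduct : List Bool → List Bool → Bool
  innerProduct (a ∷ x) (b ∷ y) = (a ∧ b) xor innerProduct x y
  innerProduct _       _       = false

  -- y is reversed because foldedIP pairs the two halves of a word from the outside in.
  χ : List Bool → List Bool → ℤ
  χ x y = sign (innerProduct x (reverse y))

  fourier : ℕ → (List Bool → ℤ) → List Bool → ℤ
  fourier m g x = ∑[ y ∈ words m ] g y * χ x y

  reverse-∷ʳ : ∀ {A : Set} (y : List A) b → reverse (y ∷ʳ b) ≡ b ∷ reverse y
  reverse-∷ʳ y b = reverse-++ y [ b ]

  χ-false∷ : ∀ x y b → χ (false ∷ x) (y ∷ʳ b) ≡ χ x y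
  χ-false∷ x y b rewrite reverse-∷ʳ y b = refl

  χ-true∷-false : ∀ x y → χ (true ∷ x) (y ∷ʳ false) ≡ χ x y
  χ-true∷-false x y rewrite reverse-∷ʳ y false = refl

  χ-true∷-true : ∀ x y → χ (true ∷ x) (y ∷ʳ true) ≡ - χ x y
  χ-true∷-true x y rewrite reverse-∷ʳ y true = sign-not (innerProduct x (reverse y))

  fourier-false∷ : ∀ m g x → fourier (suc m) g (false ∷ x) ≡ fourier m (λ y → g (y ∷ʳ false) + g (y ∷ʳ true)) x
  fourier-false∷ m g x = trans (∑-words-∷ʳ m _) (∑-words-cong m (λ y _ → begin
    g (y ∷ʳ false) * χ (false ∷ x) (y ∷ʳ false) + g (y ∷ʳ true) * χ (false ∷ x) (y ∷ʳ true)
      ≡⟨ cong₂ (λ u v → g (y ∷ʳ false) * u + g (y ∷ʳ true) * v) (χ-false∷ x y false) (χ-false∷ x y true) ⟩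
    g (y ∷ʳ false) * χ x y + g (y ∷ʳ true) * χ x y
      ≡⟨ *-distribʳ-+ (χ x y) (g (y ∷ʳ false)) (g (y ∷ʳ true)) ⟨
    (g (y ∷ʳ false) + g (y ∷ʳ true)) * χ x y ∎))
    where open ≡-Reasoning

  fourier-true∷ : ∀ m g x → fourier (suc m) g (true ∷ x) ≡ fourier m (λ y → g (y ∷ʳ false) - g (y ∷ʳ true)) x
  fourier-true∷ m g x = trans (∑-words-∷ʳ m _) (∑-words-cong m (λ y _ → begin
    g (y ∷ʳ false) * χ (true ∷ x) (y ∷ʳ false) + g (y ∷ʳ true) * χ (true ∷ x) (y ∷ʳ true)
      ≡⟨ cong₂ (λ u v → g (y ∷ʳ false) * u + g (y ∷ʳ true) * v) (χ-true∷-false x y) (χ-true∷-true x y) ⟩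
    g (y ∷ʳ false) * χ x y + g (y ∷ʳ true) * - χ x y
      ≡⟨ collect (g (y ∷ʳ false)) (g (y ∷ʳ true)) (χ x y) ⟩
    (g (y ∷ʳ false) - g (y ∷ʳ true)) * χ x y ∎))
    where
    open ≡-Reasoning
    collect : ∀ a b c → a * c + b * - c ≡ (a - b) * c
    collect = solve-∀

  -- The transform at level m + 1 splits into the transforms of the sum and the difference
  -- of g over the last letter, and (a + b)² + (a − b)² = 2(a² + b²).
  parseval : ∀ m (g : List Bool → ℤ) →
    ∑[ x ∈ words m ] fourier m g x * fourier m g x ≡ + (2 ^ m) * (∑[ y ∈ words m ] g y * g y)
  parseval zero    g = base (g [])
    where
    base : ∀ a → (a * + 1 + + 0) * (a * + 1 + + 0) + + 0 ≡ + 1 * (a * a + + 0)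
    base = solve-∀
  parseval (suc m) g = begin
    ∑[ x ∈ words (suc m) ] ĝ x * ĝ x
      ≡⟨ ∑-words-suc m _ ⟩
    ∑[ x ∈ words m ] (ĝ (false ∷ x) * ĝ (false ∷ x) + ĝ (true ∷ x) * ĝ (true ∷ x))
      ≡⟨ ∑-words-cong m (λ x _ → cong₂ _+_ (cong₂ _*_ (fourier-false∷ m g x) (fourier-false∷ m g x))
                                           (cong₂ _*_ (fourier-true∷ m g x) (fourier-true∷ m g x))) ⟩
    ∑[ x ∈ words m ] (fourier m g₊ x * fourier m g₊ x + fourier m g₋ x * fourier m g₋ x)
      ≡⟨ ∑-distrib-+ (words m) _ _ ⟩
    (∑[ x ∈ words m ] fourier m g₊ x * fourier m g₊ x) + (∑[ x ∈ words m ] fourier m g₋ x * fourier m g₋ x)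
      ≡⟨ cong₂ _+_ (parseval m g₊) (parseval m g₋) ⟩
    + (2 ^ m) * (∑[ y ∈ words m ] g₊ y * g₊ y) + + (2 ^ m) * (∑[ y ∈ words m ] g₋ y * g₋ y)
      ≡⟨ trans (sym (*-distribˡ-+ (+ (2 ^ m)) _ _)) (cong (+ (2 ^ m) *_) (sym (∑-distrib-+ (words m) _ _))) ⟩
    + (2 ^ m) * (∑[ y ∈ words m ] (g₊ y * g₊ y + g₋ y * g₋ y))
      ≡⟨ cong (+ (2 ^ m) *_) (∑-cong (words m) (λ y → sum-difference (g (y ∷ʳ false)) (g (y ∷ʳ true)))) ⟩
    + (2 ^ m) * (∑[ y ∈ words m ] (+ 2 * (g (y ∷ʳ false) * g (y ∷ʳ false) + g (y ∷ʳ true) * g (y ∷ʳ true))))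
      ≡⟨ cong (+ (2 ^ m) *_) (trans (∑-distribˡ-* (words m) (+ 2) _)
                                    (cong (+ 2 *_) (sym (∑-words-∷ʳ m (λ y → g y * g y))))) ⟩
    + (2 ^ m) * (+ 2 * (∑[ y ∈ words (suc m) ] g y * g y))
      ≡⟨ trans (sym (*-assoc (+ (2 ^ m)) (+ 2) _))
               (cong (_* (∑[ y ∈ words (suc m) ] g y * g y)) (trans (sym (pos-* (2 ^ m) 2)) (cong +_ (ℕₚ.*-comm (2 ^ m) 2)))) ⟩
    + (2 ^ suc m) * (∑[ y ∈ words (suc m) ] g y * g y)
      ∎
    where
    open ≡-Reasoning
    ĝ = fourier (suc m) g
    g₊ g₋ : List Bool → ℤ
    g₊ y = g (y ∷ʳ false) + g (y ∷ʳ true)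
    g₋ y = g (y ∷ʳ false) - g (y ∷ʳ true)
    sum-difference : ∀ a b → (a + b) * (a + b) + (a - b) * (a - b) ≡ + 2 * (a * a + b * b)
    sum-difference = solve-∀

-- The folded inner-product language and its grammar

module _ where

  open import Data.Nat using (ℕ; zero; suc; _+_; _≤_; z≤n; s≤s; ⌊_/2⌋)
  open import Data.Nat.Properties using (+-suc; +-comm; ≤-trans; ≤-reflexive; ≤-refl; m⊓n≤n; m≤m+n; ⌊n/2⌋≤n)

  foldedIP : Language Bool
  foldedIP w = innerProduct (take ⌊ length w /2⌋ w) (reverse w)

  innerProduct-++ʳ : ∀ x {y} z → length x ≤ length y → innerProduct x (y ++ z) ≡ innerProduct x y
  innerProduct-++ʳ []      z _                       = refl
  innerProduct-++ʳ (a ∷ x) {b ∷ y} z (s≤s ∣x∣≤∣y∣) = cong ((a ∧ b) xor_) (innerProduct-++ʳ x z ∣x∣≤∣y∣)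

  take-length-++ : ∀ {A : Set} (x y : List A) → take (length x) (x ++ y) ≡ x
  take-length-++ []      y = refl
  take-length-++ (a ∷ x) y = cong (a ∷_) (take-length-++ x y)

  take-++ˡ : ∀ {A : Set} n (x y : List A) → n ≤ length x → take n (x ++ y) ≡ take n x
  take-++ˡ zero    x       y _          = refl
  take-++ˡ (suc n) (a ∷ x) y (s≤s n≤∣x∣) = cong (a ∷_) (take-++ˡ n x y n≤∣x∣)

  ⌊m+[r+m]/2⌋≡m : ∀ m {r} → r ≤ 1 → ⌊ m + (r + m) /2⌋ ≡ m
  ⌊m+[r+m]/2⌋≡m zero    z≤n       = refl
  ⌊m+[r+m]/2⌋≡m zero    (s≤s z≤n) = refl
  ⌊m+[r+m]/2⌋≡m (suc m) {r} r≤1 rewrite +-suc r m | +-suc m (r + m) = cong suc (⌊m+[r+m]/2⌋≡m m r≤1)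

  foldedIP-++ : ∀ x c y → length x ≡ length y → length c ≤ 1 →
                foldedIP (x ++ c ++ y) ≡ innerProduct x (reverse y)
  foldedIP-++ x c y ∣x∣≡∣y∣ ∣c∣≤1 = begin
    innerProduct (take ⌊ length (x ++ c ++ y) /2⌋ (x ++ c ++ y)) (reverse (x ++ c ++ y))
      ≡⟨ cong (λ h → innerProduct (take h (x ++ c ++ y)) (reverse (x ++ c ++ y))) half-length ⟩
    innerProduct (take (length x) (x ++ c ++ y)) (reverse (x ++ c ++ y))
      ≡⟨ cong₂ innerProduct (take-length-++ x (c ++ y)) reverse-x++c++y ⟩
    innerProduct x ((reverse y ++ reverse c) ++ reverse x)
      ≡⟨ innerProduct-++ʳ x (reverse x) ∣x∣≤∣y′++c′∣ ⟩
    innerProduct x (reverse y ++ reverse c)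
      ≡⟨ innerProduct-++ʳ x (reverse c) ∣x∣≤∣y′∣ ⟩
    innerProduct x (reverse y) ∎
    where
    open ≡-Reasoning
    half-length : ⌊ length (x ++ c ++ y) /2⌋ ≡ length x
    half-length = begin
      ⌊ length (x ++ c ++ y) /2⌋           ≡⟨ cong ⌊_/2⌋ (trans (length-++ x) (cong (length x +_) (length-++ c))) ⟩
      ⌊ length x + (length c + length y) /2⌋ ≡⟨ cong (λ l → ⌊ length x + (length c + l) /2⌋) (sym ∣x∣≡∣y∣) ⟩
      ⌊ length x + (length c + length x) /2⌋ ≡⟨ ⌊m+[r+m]/2⌋≡m (length x) ∣c∣≤1 ⟩
      length x                             ∎
    reverse-x++c++y : reverse (x ++ c ++ y) ≡ (reverse y ++ reverse c) ++ reverse x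
    reverse-x++c++y = trans (reverse-++ x (c ++ y)) (cong (_++ reverse x) (reverse-++ c y))
    ∣x∣≤∣y′∣ : length x ≤ length (reverse y)
    ∣x∣≤∣y′∣ = ≤-reflexive (trans ∣x∣≡∣y∣ (sym (length-reverse y)))
    ∣x∣≤∣y′++c′∣ : length x ≤ length (reverse y ++ reverse c)
    ∣x∣≤∣y′++c′∣ = ≤-trans ∣x∣≤∣y′∣ (≤-trans (m≤m+n _ _) (≤-reflexive (sym (length-++ (reverse y)))))

  foldedIP-∷∷ʳ : ∀ a u b → foldedIP (a ∷ u ∷ʳ b) ≡ (a ∧ b) xor foldedIP u
  foldedIP-∷∷ʳ a u b = begin
    innerProduct (take ⌊ length (a ∷ u ∷ʳ b) /2⌋ (a ∷ u ∷ʳ b)) (reverse (a ∷ u ∷ʳ b))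
      ≡⟨ cong (λ l → innerProduct (take ⌊ suc l /2⌋ (a ∷ u ∷ʳ b)) (reverse (a ∷ u ∷ʳ b)))
              (trans (length-++ u) (+-comm (length u) 1)) ⟩
    innerProduct (a ∷ take h (u ∷ʳ b)) (reverse (a ∷ u ∷ʳ b))
      ≡⟨ cong₂ innerProduct (cong (a ∷_) (take-++ˡ h u [ b ] h≤∣u∣)) reverse-a∷u∷ʳb ⟩
    (a ∧ b) xor innerProduct (take h u) (reverse u ∷ʳ a)
      ≡⟨ cong ((a ∧ b) xor_) (innerProduct-++ʳ (take h u) [ a ] ∣take∣≤∣u′∣) ⟩
    (a ∧ b) xor foldedIP u ∎
    where
    open ≡-Reasoning
    h = ⌊ length u /2⌋
    h≤∣u∣ : h ≤ length u
    h≤∣u∣ = ⌊n/2⌋≤n (length u)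
    reverse-a∷u∷ʳb : reverse (a ∷ u ∷ʳ b) ≡ b ∷ reverse u ∷ʳ a
    reverse-a∷u∷ʳb = trans (unfold-reverse a (u ∷ʳ b)) (cong (_∷ʳ a) (reverse-++ u [ b ]))
    ∣take∣≤∣u′∣ : length (take h u) ≤ length (reverse u)
    ∣take∣≤∣u′∣ = ≤-trans (≤-reflexive (length-take h u))
                          (≤-trans (m⊓n≤n h (length u)) (≤-reflexive (sym (length-reverse u))))

  S : Bool → Fin 2
  S false = zero
  S true  = suc zero

  S-injective : ∀ {p q} → S p ≡ S q → p ≡ q
  S-injective {false} {false} _ = refl
  S-injective {true}  {true}  _ = refl

  bools : List Bool
  bools = false ∷ true ∷ []

  ∈-bools : ∀ b → b ∈ bools
  ∈-bools false = here refl
  ∈-bools true  = there (here refl)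

  bracket : Bool × Bool × Bool → Fin 2 × List (Fin 2 ⊎ Bool)
  bracket (p , a , b) = S ((a ∧ b) xor p) , inj₂ a ∷ inj₁ (S p) ∷ inj₂ b ∷ []

  foldedIP-grammar : CFG
  foldedIP-grammar = record
    { nNonterminals = 2
    ; start         = S true
    ; productions   = (S false , []) ∷ (S false , [ inj₂ false ]) ∷ (S false , [ inj₂ true ]) ∷
                      map bracket (cartesianProduct bools (cartesianProduct bools bools))
    }

  ∈-bracket : ∀ p a b → bracket (p , a , b) ∈ CFG.productions foldedIP-grammar
  ∈-bracket p a b = there (there (there (∈-map⁺ bracket
    (∈-cartesianProduct⁺ (∈-bools p) (∈-cartesianProduct⁺ (∈-bools a) (∈-bools b))))))

  foldedIP-sound : ∀ {X w} → Derives foldedIP-grammar X w → S (foldedIP w) ≡ X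
  foldedIP-sound (rule (here refl) [])                       = refl
  foldedIP-sound (rule (there (here refl)) (ter []))         = refl
  foldedIP-sound (rule (there (there (here refl))) (ter [])) = refl
  foldedIP-sound (rule (there (there (there X→rhs))) d) with ∈-map⁻ bracket X→rhs
  ... | (p , a , b) , _ , refl with d
  ...   | ter (nt {u = u} u∈Sp (ter [])) =
    cong S (trans (foldedIP-∷∷ʳ a u b) (cong ((a ∧ b) xor_) (S-injective (foldedIP-sound u∈Sp))))

  foldedIP-complete : ∀ n w → length w ≤ n → Derives foldedIP-grammar (S (foldedIP w)) w
  foldedIP-complete _       []      _ = rule (here refl) []
  foldedIP-complete (suc n) (a ∷ v) (s≤s ∣v∣≤n) with reverseView v
  ... | [] with a
  ...   | false = rule (there (here refl)) (ter [])
  ...   | true  = rule (there (there (here refl))) (ter [])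
  foldedIP-complete (suc n) (a ∷ v) (s≤s ∣v∣≤n) | u ∶ _ ∶ʳ b =
    subst (λ q → Derives foldedIP-grammar (S q) (a ∷ u ∷ʳ b)) (sym (foldedIP-∷∷ʳ a u b))
          (rule (∈-bracket (foldedIP u) a b) (ter (nt (foldedIP-complete n u ∣u∣≤n) (ter []))))
    where
    ∣u∣≤n : length u ≤ n
    ∣u∣≤n = ≤-trans (m≤m+n (length u) 1) (≤-trans (≤-reflexive (sym (length-++ u))) ∣v∣≤n)

  foldedIP-contextFree : ContextFree foldedIP
  foldedIP-contextFree = foldedIP-grammar , λ w →
    mk⇔ (λ w∈L → subst (λ q → Derives foldedIP-grammar (S q) w) w∈L (foldedIP-complete (length w) w ≤-refl))
        (λ derivation → S-injective (foldedIP-sound derivation))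

-- Correlation with a language that splits through few states

module _ where

  open import Data.Nat as ℕ using (ℕ; _^_; s≤s; z≤n)
  import Data.Nat.Properties as ℕₚ
  open import Data.Integer using (ℤ; +_; -_; _+_; _-_; _*_; _≤_; +≤+; ∣_∣; nonNegative)
  open import Data.Integer.Properties
  open import Data.Integer.Tactic.RingSolver using (solve-∀)

  ∑-*-fourier-bound : ∀ m (f g : List Bool → ℤ) G → (∀ x → f x * f x ≤ + 1) → (∀ y → g y * g y ≤ G) →
    let D = ∑[ x ∈ words m ] f x * fourier m g x in
    D * D ≤ + (2 ^ m) * (+ (2 ^ m) * (G * + (2 ^ m)))
  ∑-*-fourier-bound m f g G f²≤1 g²≤G = begin
    (∑[ x ∈ words m ] f x * ĝ x) * (∑[ x ∈ words m ] f x * ĝ x)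
      ≤⟨ cauchy-schwarz (words m) f ĝ ⟩
    (∑[ x ∈ words m ] f x * f x) * (∑[ x ∈ words m ] ĝ x * ĝ x)
      ≤⟨ *-monoʳ-≤-nonNeg (∑[ x ∈ words m ] ĝ x * ĝ x) {{nonNegative ∑ĝ²≥0}} ∑f²≤T ⟩
    T * (∑[ x ∈ words m ] ĝ x * ĝ x)
      ≡⟨ cong (T *_) (parseval m g) ⟩
    T * (T * (∑[ y ∈ words m ] g y * g y))
      ≤⟨ *-monoˡ-≤-nonNeg T (*-monoˡ-≤-nonNeg T ∑g²≤GT) ⟩
    T * (T * (G * T)) ∎
    where
    open ≤-Reasoning
    ĝ = fourier m g
    T = + (2 ^ m)
    ∑ĝ²≥0 : + 0 ≤ ∑[ x ∈ words m ] ĝ x * ĝ x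
    ∑ĝ²≥0 = ∑-nonNeg (words m) (λ x → square-nonNeg (ĝ x))
    ∑f²≤T : ∑[ x ∈ words m ] f x * f x ≤ T
    ∑f²≤T = subst ((∑[ x ∈ words m ] f x * f x) ≤_) (trans (cong (λ l → + l * + 1) (length-words m)) (*-identityʳ T))
                  (∑-≤-const (words m) (+ 1) f²≤1)
    ∑g²≤GT : ∑[ y ∈ words m ] g y * g y ≤ G * T
    ∑g²≤GT = subst ((∑[ y ∈ words m ] g y * g y) ≤_) (trans (cong (λ l → + l * G) (length-words m)) (*-comm T G))
                   (∑-≤-const (words m) G g²≤G)

  correlation : Language Bool → Language Bool → ℕ → ℤ
  correlation L A n = ∑[ w ∈ words n ] sign (L w xor A w)

  ∣2*symDiffCount-2^n∣≡∣correlation∣ : ∀ L A n →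
    ∣ + 2 * + symDiffCount L A n - + (2 ^ n) ∣ ≡ ∣ correlation L A n ∣
  ∣2*symDiffCount-2^n∣≡∣correlation∣ L A n = begin
    ∣ X - + (2 ^ n) ∣   ≡⟨ cong (λ K → ∣ X - K ∣) (trans (cong +_ (sym (length-words n))) (sym E+X≡2^n)) ⟩
    ∣ X - (E + X) ∣     ≡⟨ cong ∣_∣ (cancel E X) ⟩
    ∣ - E ∣             ≡⟨ ∣-i∣≡∣i∣ E ⟩
    ∣ E ∣               ∎
    where
    open ≡-Reasoning
    E = correlation L A n
    X = + 2 * + symDiffCount L A n
    E+X≡2^n : E + X ≡ + length (words n)
    E+X≡2^n = ∑-sign (words n) (λ w → L w xor A w)
    cancel : ∀ e x → x - (e + x) ≡ - e
    cancel = solve-∀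

  δ : ∀ {N} → Fin N → Fin N → ℤ
  δ zero    zero    = + 1
  δ zero    (suc _) = + 0
  δ (suc _) zero    = + 0
  δ (suc s) (suc t) = δ s t

  δ*δ≤1 : ∀ {N} (s t : Fin N) → δ s t * δ s t ≤ + 1
  δ*δ≤1 zero    zero    = +≤+ (s≤s z≤n)
  δ*δ≤1 zero    (suc _) = +≤+ z≤n
  δ*δ≤1 (suc _) zero    = +≤+ z≤n
  δ*δ≤1 (suc s) (suc t) = δ*δ≤1 s t

  ∑-allFin-suc : ∀ N (h : Fin (ℕ.suc N) → ℤ) → ∑ (allFin (ℕ.suc N)) h ≡ h zero + (∑[ s ∈ allFin N ] h (suc s))
  ∑-allFin-suc N h = cong (_+_ (h zero)) (trans (cong (λ xs → ∑ xs h) (sym (map-tabulate id suc))) (∑-map (allFin N) suc h))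

  ∑-δ : ∀ {N} (t : Fin N) (v : Fin N → ℤ) → ∑[ s ∈ allFin N ] δ t s * v s ≡ v t
  ∑-δ {ℕ.suc N} zero v = begin
    ∑[ s ∈ allFin (ℕ.suc N) ] δ zero s * v s         ≡⟨ ∑-allFin-suc N (λ s → δ zero s * v s) ⟩
    + 1 * v zero + (∑[ s ∈ allFin N ] + 0 * v (suc s))
      ≡⟨ cong₂ _+_ (*-identityˡ (v zero)) (∑-cong (allFin N) (λ s → *-zeroˡ (v (suc s)))) ⟩
    v zero + (∑[ s ∈ allFin N ] + 0)
      ≡⟨ trans (cong (_+_ (v zero)) (∑-zero (allFin N))) (+-identityʳ (v zero)) ⟩
    v zero                                          ∎
    where open ≡-Reasoning
  ∑-δ {ℕ.suc N} (suc t) v = begin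
    ∑[ s ∈ allFin (ℕ.suc N) ] δ (suc t) s * v s           ≡⟨ ∑-allFin-suc N (λ s → δ (suc t) s * v s) ⟩
    + 0 * v zero + (∑[ s ∈ allFin N ] δ t s * v (suc s)) ≡⟨ +-identityˡ _ ⟩
    ∑[ s ∈ allFin N ] δ t s * v (suc s)                ≡⟨ ∑-δ t (v ∘ suc) ⟩
    v (suc t)                                          ∎
    where open ≡-Reasoning

  record StateSplitting (N : ℕ) (A : Language Bool) (m k : ℕ) : Set where
    field
      state  : List Bool → Fin N
      accept : Fin N → List Bool → Bool
      split  : ∀ x z → length x ≡ m → length z ≡ k → A (x ++ z) ≡ accept (state x) z

  module _ {N A m r} (r≤1 : r ℕ.≤ 1) (splitting : StateSplitting N A m (r ℕ.+ m)) where
    open StateSplitting splitting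

    private
      n = m ℕ.+ (r ℕ.+ m)
      E = correlation foldedIP A n

      e : Fin N → List Bool → ℤ
      e s z = sign (accept s z)

      g : Fin N → List Bool → ℤ
      g s y = ∑[ c ∈ words r ] e s (c ++ y)

      D : Fin N → ℤ
      D s = ∑[ x ∈ words m ] δ (state x) s * fourier m (g s) x

    ∑-suffixes : ∀ x → length x ≡ m →
      ∑[ z ∈ words (r ℕ.+ m) ] sign (foldedIP (x ++ z) xor A (x ++ z)) ≡ fourier m (g (state x)) x
    ∑-suffixes x ∣x∣≡m = begin
      ∑[ z ∈ words (r ℕ.+ m) ] sign (foldedIP (x ++ z) xor A (x ++ z))
        ≡⟨ ∑-words-++ r m _ ⟩
      ∑[ c ∈ words r ] ∑[ y ∈ words m ] sign (foldedIP (x ++ c ++ y) xor A (x ++ c ++ y))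
        ≡⟨ ∑-words-cong r (λ c ∣c∣≡r → ∑-words-cong m (λ y ∣y∣≡m → pointwise c y ∣c∣≡r ∣y∣≡m)) ⟩
      ∑[ c ∈ words r ] ∑[ y ∈ words m ] e (state x) (c ++ y) * χ x y
        ≡⟨ ∑-comm (words r) (words m) _ ⟩
      ∑[ y ∈ words m ] ∑[ c ∈ words r ] e (state x) (c ++ y) * χ x y
        ≡⟨ ∑-cong (words m) (λ y → ∑-distribʳ-* (words r) (χ x y) _) ⟩
      fourier m (g (state x)) x ∎
      where
      open ≡-Reasoning
      pointwise : ∀ c y → length c ≡ r → length y ≡ m →
        sign (foldedIP (x ++ c ++ y) xor A (x ++ c ++ y)) ≡ e (state x) (c ++ y) * χ x y
      pointwise c y ∣c∣≡r ∣y∣≡m = begin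
        sign (foldedIP (x ++ c ++ y) xor A (x ++ c ++ y))
          ≡⟨ sign-xor (foldedIP (x ++ c ++ y)) (A (x ++ c ++ y)) ⟩
        sign (foldedIP (x ++ c ++ y)) * sign (A (x ++ c ++ y))
          ≡⟨ cong₂ (λ u v → sign u * sign v)
                   (foldedIP-++ x c y (trans ∣x∣≡m (sym ∣y∣≡m)) (ℕₚ.≤-trans (ℕₚ.≤-reflexive ∣c∣≡r) r≤1))
                   (split x (c ++ y) ∣x∣≡m (trans (length-++ c) (cong₂ ℕ._+_ ∣c∣≡r ∣y∣≡m))) ⟩
        χ x y * e (state x) (c ++ y)
          ≡⟨ *-comm (χ x y) _ ⟩
        e (state x) (c ++ y) * χ x y ∎

    correlation≡∑-states : E ≡ ∑[ s ∈ allFin N ] D s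
    correlation≡∑-states = begin
      ∑[ w ∈ words n ] sign (foldedIP w xor A w)
        ≡⟨ ∑-words-++ m (r ℕ.+ m) _ ⟩
      ∑[ x ∈ words m ] ∑[ z ∈ words (r ℕ.+ m) ] sign (foldedIP (x ++ z) xor A (x ++ z))
        ≡⟨ ∑-words-cong m ∑-suffixes ⟩
      ∑[ x ∈ words m ] fourier m (g (state x)) x
        ≡⟨ ∑-cong (words m) (λ x → sym (∑-δ (state x) (λ s → fourier m (g s) x))) ⟩
      ∑[ x ∈ words m ] ∑[ s ∈ allFin N ] δ (state x) s * fourier m (g s) x
        ≡⟨ ∑-comm (words m) (allFin N) _ ⟩
      ∑[ s ∈ allFin N ] D s ∎
      where open ≡-Reasoning

    private
      T R : ℤ
      T = + (2 ^ m)
      R = + (2 ^ r)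

    g*g≤R*R : ∀ s y → g s y * g s y ≤ R * R
    g*g≤R*R s y = begin
      g s y * g s y
        ≤⟨ ∑-square-≤ (words r) (λ c → e s (c ++ y)) ⟩
      + length (words r) * (∑[ c ∈ words r ] e s (c ++ y) * e s (c ++ y))
        ≡⟨ cong₂ _*_ (cong +_ (length-words r))
                     (trans (∑-cong (words r) (λ c → sign*sign≡1 (accept s (c ++ y)))) (∑-words-one r)) ⟩
      R * R ∎
      where open ≤-Reasoning

    D*D≤ : ∀ s → D s * D s ≤ T * (T * (R * R * T))
    D*D≤ s = ∑-*-fourier-bound m (λ x → δ (state x) s) (g s) (R * R) (λ x → δ*δ≤1 (state x) s) (g*g≤R*R s)

    correlation*correlation≤ : E * E ≤ + N * (+ N * (T * (T * (R * R * T))))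
    correlation*correlation≤ = begin
      E * E
        ≡⟨ cong₂ _*_ correlation≡∑-states correlation≡∑-states ⟩
      (∑[ s ∈ allFin N ] D s) * (∑[ s ∈ allFin N ] D s)
        ≤⟨ ∑-square-≤ (allFin N) D ⟩
      + length (allFin N) * (∑[ s ∈ allFin N ] D s * D s)
        ≤⟨ *-monoˡ-≤-nonNeg (+ length (allFin N)) (∑-≤-const (allFin N) _ D*D≤) ⟩
      + length (allFin N) * (+ length (allFin N) * (T * (T * (R * R * T))))
        ≡⟨ cong (λ l → + l * (+ l * (T * (T * (R * R * T))))) (length-tabulate {n = N} id) ⟩
      + N * (+ N * (T * (T * (R * R * T)))) ∎
      where open ≤-Reasoning

    correlation-bound : 2 ^ m ℕ.* (∣ E ∣ ℕ.* ∣ E ∣) ℕ.≤ (N ℕ.* 2 ^ n) ℕ.* (N ℕ.* 2 ^ n)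
    correlation-bound = drop‿+≤+ (begin
      + (2 ^ m ℕ.* (∣ E ∣ ℕ.* ∣ E ∣))
        ≡⟨ trans (pos-* (2 ^ m) _) (cong (T *_) (+[∣i∣*∣i∣]≡i*i E)) ⟩
      T * (E * E)
        ≤⟨ *-monoˡ-≤-nonNeg T correlation*correlation≤ ⟩
      T * (+ N * (+ N * (T * (T * (R * R * T)))))
        ≡⟨ rearrange T R (+ N) ⟩
      (+ N * (T * (R * T))) * (+ N * (T * (R * T)))
        ≡⟨ sym (cong (λ K → (+ N * K) * (+ N * K)) +2^n≡T*[R*T]) ⟩
      (+ N * + (2 ^ n)) * (+ N * + (2 ^ n))
        ≡⟨ sym (trans (pos-* (N ℕ.* 2 ^ n) _) (cong₂ _*_ (pos-* N _) (pos-* N _))) ⟩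
      + ((N ℕ.* 2 ^ n) ℕ.* (N ℕ.* 2 ^ n)) ∎)
      where
      open ≤-Reasoning
      rearrange : ∀ T R N → T * (N * (N * (T * (T * (R * R * T))))) ≡ (N * (T * (R * T))) * (N * (T * (R * T)))
      rearrange = solve-∀
      +2^n≡T*[R*T] : + (2 ^ n) ≡ T * (R * T)
      +2^n≡T*[R*T] = trans (cong +_ (trans (ℕₚ.^-distribˡ-+-* 2 m (r ℕ.+ m)) (cong (2 ^ m ℕ.*_) (ℕₚ.^-distribˡ-+-* 2 r m))))
                           (trans (pos-* (2 ^ m) _) (cong (T *_) (pos-* (2 ^ r) _)))

-- REG/n languages split through the automaton's states

module _ where

  open import Data.Nat using (_+_)
  open import Data.Vec using (toList)

  run-++ : ∀ {X : Set} (D : DFA X) q u v → run D q (u ++ v) ≡ run D (run D q u) v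
  run-++ D q []      v = refl
  run-++ D q (a ∷ u) v = run-++ D (DFA.step D q a) u v

  zip-++ : ∀ {X Y : Set} (x z : List X) (ys : List Y) → zip (x ++ z) ys ≡ zip x ys ++ zip z (drop (length x) ys)
  zip-++ []      z ys       = refl
  zip-++ (a ∷ x) []  []     = refl
  zip-++ (a ∷ x) (_ ∷ _) [] = refl
  zip-++ (a ∷ x) z (b ∷ ys) = cong ((a , b) ∷_) (zip-++ x z ys)

  -- Once m and k are fixed so is the advice h(m + k), and the automaton's state after
  -- reading the first m letters is all that matters about them.
  REG/n⇒splitting : ∀ {A} → REG/n A → ∃ λ N → ∀ m k → StateSplitting N A m k
  REG/n⇒splitting {A} (_ , h , A′ , (D , A′≡D) , A≡A′) = DFA.nStates D , splitting
    where
    open DFA D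
    splitting : ∀ m k → StateSplitting nStates A m k
    splitting m k = record { state = state ; accept = accept ; split = split }
      where
      H = toList (h (m + k))
      state : List Bool → Fin nStates
      state x = run D start (zip x H)
      accept : Fin nStates → List Bool → Bool
      accept q z = final (run D q (zip z (drop m H)))
      split : ∀ x z → length x ≡ m → length z ≡ k → A (x ++ z) ≡ accept (state x) z
      split x z ∣x∣≡m ∣z∣≡k = begin
        A (x ++ z)                                                   ≡⟨ A≡A′ (x ++ z) ⟩
        A′ (zip (x ++ z) (toList (h (length (x ++ z)))))
          ≡⟨ cong (λ l → A′ (zip (x ++ z) (toList (h l)))) ∣x++z∣≡m+k ⟩
        A′ (zip (x ++ z) H)                                          ≡⟨ A′≡D (zip (x ++ z) H) ⟩
        final (run D start (zip (x ++ z) H))                         ≡⟨ cong (final ∘ run D start) (zip-++ x z H) ⟩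
        final (run D start (zip x H ++ zip z (drop (length x) H)))   ≡⟨ cong final (run-++ D start (zip x H) _) ⟩
        final (run D (state x) (zip z (drop (length x) H)))
          ≡⟨ cong (λ l → final (run D (state x) (zip z (drop l H)))) ∣x∣≡m ⟩
        accept (state x) z                                           ∎
        where
        open ≡-Reasoning
        ∣x++z∣≡m+k : length (x ++ z) ≡ m + k
        ∣x++z∣≡m+k = trans (length-++ x) (cong₂ _+_ ∣x∣≡m ∣z∣≡k)

-- Polynomials against exponentials

module _ where

  open import Data.Nat
  open import Data.Nat.Properties
  open import Data.Nat.Tactic.RingSolver using (solve-∀)

  Eventually : (ℕ → Set) → Set
  Eventually P = ∃ λ M → ∀ n → M ≤ n → P n

  parity-split : ∀ n → ∃ λ r → r ≤ 1 × n ≡ ⌊ n /2⌋ + (r + ⌊ n /2⌋)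
  parity-split zero          = 0 , z≤n , refl
  parity-split (suc zero)    = 1 , s≤s z≤n , refl
  parity-split (suc (suc n)) with parity-split n
  ... | r , r≤1 , n≡ = r , r≤1 , cong suc (trans (cong suc n≡)
    (sym (trans (cong (⌊ n /2⌋ +_) (+-suc r ⌊ n /2⌋)) (+-suc ⌊ n /2⌋ (r + ⌊ n /2⌋)))))

  ⌊n/2⌋+⌊n/2⌋≤n : ∀ n → ⌊ n /2⌋ + ⌊ n /2⌋ ≤ n
  ⌊n/2⌋+⌊n/2⌋≤n n with parity-split n
  ... | r , _ , n≡ = subst (⌊ n /2⌋ + ⌊ n /2⌋ ≤_) (sym n≡) (+-monoʳ-≤ ⌊ n /2⌋ (m≤n+m ⌊ n /2⌋ r))

  1+n≤2*[1+⌊n/2⌋] : ∀ n → suc n ≤ 2 * suc ⌊ n /2⌋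
  1+n≤2*[1+⌊n/2⌋] n with parity-split n
  ... | r , r≤1 , n≡ = begin
    suc n                           ≡⟨ cong suc n≡ ⟩
    suc (⌊ n /2⌋ + (r + ⌊ n /2⌋))   ≤⟨ s≤s (+-monoʳ-≤ ⌊ n /2⌋ (+-monoˡ-≤ ⌊ n /2⌋ r≤1)) ⟩
    suc (⌊ n /2⌋ + (1 + ⌊ n /2⌋))   ≡⟨ double-suc ⌊ n /2⌋ ⟩
    2 * suc ⌊ n /2⌋                 ∎
    where
    open ≤-Reasoning
    double-suc : ∀ h → suc (h + (1 + h)) ≡ 2 * suc h
    double-suc = solve-∀

  m+m≤n⇒m≤⌊n/2⌋ : ∀ {m n} → m + m ≤ n → m ≤ ⌊ n /2⌋
  m+m≤n⇒m≤⌊n/2⌋ {m} m+m≤n = ≤-trans (≤-reflexive (n≡⌊n+n/2⌋ m)) (⌊n/2⌋-mono m+m≤n)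

  n<2^n : ∀ n → n < 2 ^ n
  n<2^n zero    = s≤s z≤n
  n<2^n (suc n) = begin-strict
    suc n           ≤⟨ n<2^n n ⟩
    2 ^ n           <⟨ m<m+n (2 ^ n) (m^n>0 2 n) ⟩
    2 ^ n + 2 ^ n   ≡⟨ cong (2 ^ n +_) (sym (+-identityʳ (2 ^ n))) ⟩
    2 ^ suc n       ∎
    where open ≤-Reasoning

  m≤m*m : ∀ m → m ≤ m * m
  m≤m*m zero        = z≤n
  m≤m*m m@(suc _)   = m≤m*n m m

  ^-distrib-* : ∀ m n o → (m * n) ^ o ≡ m ^ o * n ^ o
  ^-distrib-* m n zero    = refl
  ^-distrib-* m n (suc o) = trans (cong (m * n *_) (^-distrib-* m n o)) (interchange m n (m ^ o) (n ^ o))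
    where
    interchange : ∀ a b c d → a * b * (c * d) ≡ a * c * (b * d)
    interchange = solve-∀

  ExponentiallyDominated : ℕ → Set
  ExponentiallyDominated e = ∀ K → Eventually (λ n → K * suc n ^ e ≤ 2 ^ n)

  -- With h = ⌊n/2⌋ ≥ 2K:  K (n + 1) ≤ 2K (h + 1) ≤ 2^h 2^h ≤ 2^n.
  exponentiallyDominated-1 : ExponentiallyDominated 1
  exponentiallyDominated-1 K = K * 4 , bound
    where
    bound : ∀ n → K * 4 ≤ n → K * suc n ^ 1 ≤ 2 ^ n
    bound n 4K≤n = begin
      K * suc n ^ 1       ≡⟨ cong (K *_) (*-identityʳ (suc n)) ⟩
      K * suc n           ≤⟨ *-monoʳ-≤ K (1+n≤2*[1+⌊n/2⌋] n) ⟩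
      K * (2 * suc h)     ≡⟨ *-assoc K 2 (suc h) ⟨
      K * 2 * suc h       ≤⟨ *-mono-≤ (<⇒≤ 2K<2^h) (n<2^n h) ⟩
      2 ^ h * 2 ^ h       ≡⟨ ^-distribˡ-+-* 2 h h ⟨
      2 ^ (h + h)         ≤⟨ ^-monoʳ-≤ 2 (⌊n/2⌋+⌊n/2⌋≤n n) ⟩
      2 ^ n               ∎
      where
      open ≤-Reasoning
      h = ⌊ n /2⌋
      2K+2K≡4K : ∀ K → K * 2 + K * 2 ≡ K * 4
      2K+2K≡4K = solve-∀
      2K<2^h : K * 2 < 2 ^ h
      2K<2^h = ≤-<-trans (m+m≤n⇒m≤⌊n/2⌋ (≤-trans (≤-reflexive (2K+2K≡4K K)) 4K≤n)) (n<2^n h)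

  -- Squaring: if K′ (h + 1)^e ≤ 2^h for h = ⌊n/2⌋, with K′ = K 2^(2e), then
  -- K (n + 1)^(2e) ≤ K′ (h + 1)^(2e) ≤ (K′ (h + 1)^e)² ≤ 2^(2h) ≤ 2^n.
  exponentiallyDominated-double : ∀ e → ExponentiallyDominated e → ExponentiallyDominated (e + e)
  exponentiallyDominated-double e dominated K with dominated (K * 2 ^ (e + e))
  ... | M , K′[1+h]^e≤2^h = M + M , bound
    where
    K′ = K * 2 ^ (e + e)
    bound : ∀ n → M + M ≤ n → K * suc n ^ (e + e) ≤ 2 ^ n
    bound n 2M≤n = begin
      K * suc n ^ (e + e)                 ≤⟨ *-monoʳ-≤ K (^-monoˡ-≤ (e + e) (1+n≤2*[1+⌊n/2⌋] n)) ⟩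
      K * (2 * suc h) ^ (e + e)           ≡⟨ cong (K *_) (^-distrib-* 2 (suc h) (e + e)) ⟩
      K * (2 ^ (e + e) * suc h ^ (e + e)) ≡⟨ *-assoc K _ _ ⟨
      K′ * suc h ^ (e + e)                ≡⟨ cong (K′ *_) (^-distribˡ-+-* (suc h) e e) ⟩
      K′ * (X * X)                        ≤⟨ *-monoˡ-≤ (X * X) (m≤m*m K′) ⟩
      K′ * K′ * (X * X)                   ≡⟨ interchange K′ X ⟩
      (K′ * X) * (K′ * X)                 ≤⟨ *-mono-≤ K′X≤2^h K′X≤2^h ⟩
      2 ^ h * 2 ^ h                       ≡⟨ ^-distribˡ-+-* 2 h h ⟨
      2 ^ (h + h)                         ≤⟨ ^-monoʳ-≤ 2 (⌊n/2⌋+⌊n/2⌋≤n n) ⟩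
      2 ^ n                               ∎
      where
      open ≤-Reasoning
      h = ⌊ n /2⌋
      X = suc h ^ e
      K′X≤2^h : K′ * X ≤ 2 ^ h
      K′X≤2^h = K′[1+h]^e≤2^h h (m+m≤n⇒m≤⌊n/2⌋ 2M≤n)
      interchange : ∀ k x → k * k * (x * x) ≡ (k * x) * (k * x)
      interchange = solve-∀

  exponentiallyDominated-mono : ∀ {d e} → d ≤ e → ExponentiallyDominated e → ExponentiallyDominated d
  exponentiallyDominated-mono d≤e dominated K with dominated K
  ... | M , bound = M , λ n M≤n → ≤-trans (*-monoʳ-≤ K (^-monoʳ-≤ (suc n) d≤e)) (bound n M≤n)

  exponentiallyDominated : ∀ e → ExponentiallyDominated e
  exponentiallyDominated e = exponentiallyDominated-mono (n≤1+n e) (dominated-suc e)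
    where
    dominated-suc : ∀ e → ExponentiallyDominated (suc e)
    dominated-suc zero    = exponentiallyDominated-1
    dominated-suc (suc e) = exponentiallyDominated-mono (s≤s (m≤n+m (suc e) e))
                              (exponentiallyDominated-double (suc e) (dominated-suc e))

  evalCoeffs≤ : ∀ cs x → evalCoeffs cs x ≤ sum cs * suc x ^ length cs
  evalCoeffs≤ []       x = z≤n
  evalCoeffs≤ (c ∷ cs) x = begin
    c + x * evalCoeffs cs x                 ≤⟨ +-mono-≤ (m≤m*n c (suc x * X) {{m^n≢0 (suc x) (suc (length cs))}})
                                                        (*-mono-≤ (n≤1+n x) (evalCoeffs≤ cs x)) ⟩
    c * (suc x * X) + suc x * (sum cs * X)  ≡⟨ collect c (sum cs) (suc x) X ⟩
    (c + sum cs) * (suc x * X)              ∎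
    where
    open ≤-Reasoning
    X = suc x ^ length cs
    collect : ∀ c s y X → c * (y * X) + y * (s * X) ≡ (c + s) * (y * X)
    collect = solve-∀

  -- p(n) ≤ C (n + 1)^d ≤ C 2^d (h + 1)^d for h = ⌊n/2⌋, and then exponential domination in h.
  poly²≤2^⌊n/2⌋ : ∀ N p → Eventually (λ n → (N * eval p n) * (N * eval p n) ≤ 2 ^ ⌊ n /2⌋)
  poly²≤2^⌊n/2⌋ N p = M + M , bound
    where
    d = length (coeffs p)
    C = sum (coeffs p)
    K = N * (C * 2 ^ d)
    M = proj₁ (exponentiallyDominated (d + d) (K * K))
    dominated = proj₂ (exponentiallyDominated (d + d) (K * K))
    bound : ∀ n → M + M ≤ n → (N * eval p n) * (N * eval p n) ≤ 2 ^ ⌊ n /2⌋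
    bound n 2M≤n = begin
      (N * eval p n) * (N * eval p n) ≤⟨ *-mono-≤ Np≤KX Np≤KX ⟩
      (K * X) * (K * X)               ≡⟨ interchange K X ⟩
      K * K * (X * X)                 ≡⟨ cong (K * K *_) (^-distribˡ-+-* (suc h) d d) ⟨
      K * K * suc h ^ (d + d)         ≤⟨ dominated h (m+m≤n⇒m≤⌊n/2⌋ 2M≤n) ⟩
      2 ^ h                           ∎
      where
      open ≤-Reasoning
      h = ⌊ n /2⌋
      X = suc h ^ d
      interchange : ∀ k x → (k * x) * (k * x) ≡ k * k * (x * x)
      interchange = solve-∀
      reassociate : ∀ N C t X → N * (C * (t * X)) ≡ N * (C * t) * X
      reassociate = solve-∀
      Np≤KX : N * eval p n ≤ K * X
      Np≤KX = begin
        N * eval p n              ≤⟨ *-monoʳ-≤ N (evalCoeffs≤ (coeffs p) n) ⟩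
        N * (C * suc n ^ d)       ≤⟨ *-monoʳ-≤ N (*-monoʳ-≤ C (^-monoˡ-≤ d (1+n≤2*[1+⌊n/2⌋] n))) ⟩
        N * (C * (2 * suc h) ^ d) ≡⟨ cong (λ t → N * (C * t)) (^-distrib-* 2 (suc h) d) ⟩
        N * (C * (2 ^ d * X))     ≡⟨ reassociate N C (2 ^ d) X ⟩
        K * X                     ∎

module _ where

  open import Data.Nat as ℕ using (ℕ; suc; NonZero)
  import Data.Nat.Properties as ℕₚ
  open import Data.Integer as ℤ using (ℤ; +_; +≤+)
  import Data.Integer.Properties as ℤₚ
  open import Data.Integer.Tactic.RingSolver using (solve-∀)
  open import Data.Rational using (mkℚ; _/_; ∣_∣; _-_; _*_; _≤_; ½; 1ℚ; toℚᵘ)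
  open import Data.Rational.Properties using (toℚᵘ-cancel-≤; toℚᵘ-homo-*; toℚᵘ-homo-+; toℚᵘ-homo‿-; toℚᵘ-fromℚᵘ)
  open import Data.Rational.Unnormalised as ℚᵘ using (ℚᵘ; mkℚᵘ; _≃_; *≤*)
  import Data.Rational.Unnormalised.Properties as ℚᵘₚ

  toℚᵘ-∣∣ : ∀ q → toℚᵘ ∣ q ∣ ≡ ℚᵘ.∣ toℚᵘ q ∣
  toℚᵘ-∣∣ (mkℚ _ _ _) = refl

  -- Computed in unnormalised rationals: there ∣c/K − ½∣·P is literally ∣2c − K∣·P / 2K.
  ∣c/K-½∣*P≤1 : ∀ c K P .{{_ : NonZero K}} → ℤ.∣ + 2 ℤ.* + c ℤ.- + K ∣ ℕ.* P ℕ.≤ 2 ℕ.* K →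
                ∣ + c / K - ½ ∣ * (+ P / 1) ≤ 1ℚ
  ∣c/K-½∣*P≤1 c K@(suc k) P bound =
    toℚᵘ-cancel-≤ (ℚᵘₚ.≤-respˡ-≃ (ℚᵘₚ.≃-sym toℚᵘ-lhs) (*≤* cross-multiplied))
    where
    lhsᵘ : ℚᵘ
    lhsᵘ = ℚᵘ.∣ mkℚᵘ (+ c) k ℚᵘ.+ ℚᵘ.- mkℚᵘ (+ 1) 1 ∣ ℚᵘ.* mkℚᵘ (+ P) 0
    toℚᵘ-lhs : toℚᵘ (∣ + c / K - ½ ∣ * (+ P / 1)) ≃ lhsᵘ
    toℚᵘ-lhs = ℚᵘₚ.≃-trans (toℚᵘ-homo-* ∣ + c / K - ½ ∣ (+ P / 1)) (ℚᵘₚ.*-cong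
      (ℚᵘₚ.≃-trans (ℚᵘₚ.≃-reflexive (toℚᵘ-∣∣ (+ c / K - ½))) (ℚᵘₚ.∣-∣-cong
        (ℚᵘₚ.≃-trans (toℚᵘ-homo-+ (+ c / K) (Data.Rational.- ½))
          (ℚᵘₚ.+-cong (toℚᵘ-fromℚᵘ (mkℚᵘ (+ c) k)) (toℚᵘ-homo‿- ½)))))
      (toℚᵘ-fromℚᵘ (mkℚᵘ (+ P) 0)))
    numerator : + c ℤ.* + 2 ℤ.+ ℤ.- (+ 1) ℤ.* + K ≡ + 2 ℤ.* + c ℤ.- + K
    numerator = rearrange (+ c) (+ K)
      where
      rearrange : ∀ a b → a ℤ.* + 2 ℤ.+ ℤ.- (+ 1) ℤ.* b ≡ + 2 ℤ.* a ℤ.- b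
      rearrange = solve-∀
    cross-multiplied : (+ ℤ.∣ + c ℤ.* + 2 ℤ.+ ℤ.- (+ 1) ℤ.* + K ∣ ℤ.* + P) ℤ.* + 1 ℤ.≤ + 1 ℤ.* + ((K ℕ.* 2) ℕ.* 1)
    cross-multiplied = subst₂ ℤ._≤_
      (sym (trans (ℤₚ.*-identityʳ _) (trans (sym (ℤₚ.pos-* ℤ.∣ + c ℤ.* + 2 ℤ.+ ℤ.- (+ 1) ℤ.* + K ∣ P))
                                            (cong (λ t → + (ℤ.∣ t ∣ ℕ.* P)) numerator))))
      (sym (trans (ℤₚ.*-identityˡ _) (cong +_ (trans (ℕₚ.*-identityʳ _) (ℕₚ.*-comm K 2)))))
      (+≤+ bound)

module _ where

  open import Data.Nat
  open import Data.Nat.Properties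
  open import Data.Nat.Tactic.RingSolver using (solve-∀)
  open import Data.Integer as ℤ using ()
  open import Relation.Nullary using (yes; no; contradiction)

  foldedIP-correlation-bound : ∀ {N A} → (∀ m k → StateSplitting N A m k) → ∀ n →
    2 ^ ⌊ n /2⌋ * (ℤ.∣ correlation foldedIP A n ∣ * ℤ.∣ correlation foldedIP A n ∣) ≤ (N * 2 ^ n) * (N * 2 ^ n)
  foldedIP-correlation-bound {N} {A} splits n with parity-split n
  ... | r , r≤1 , n≡ = subst (λ k → 2 ^ ⌊ n /2⌋ * (ℤ.∣ correlation foldedIP A k ∣ * ℤ.∣ correlation foldedIP A k ∣)
                                      ≤ (N * 2 ^ k) * (N * 2 ^ k))
                             (sym n≡) (correlation-bound r≤1 (splits ⌊ n /2⌋ (r + ⌊ n /2⌋)))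

  m*m≤n*n⇒m≤n : ∀ {m n} → m * m ≤ n * n → m ≤ n
  m*m≤n*n⇒m≤n {m} {n} m²≤n² with m ≤? n
  ... | yes m≤n = m≤n
  ... | no  m≰n = contradiction m²≤n² (<⇒≱ (*-mono-< (≰⇒> m≰n) (≰⇒> m≰n)))

  ≤-from-weighted-squares : ∀ T e N K P .{{_ : NonZero T}} →
    T * (e * e) ≤ (N * K) * (N * K) → (N * P) * (N * P) ≤ T → e * P ≤ K
  ≤-from-weighted-squares T e N K P Te²≤[NK]² [NP]²≤T = m*m≤n*n⇒m≤n (*-cancelˡ-≤ T (begin
    T * ((e * P) * (e * P))          ≡⟨ regroup₁ T e P ⟩
    (T * (e * e)) * (P * P)          ≤⟨ *-monoˡ-≤ (P * P) Te²≤[NK]² ⟩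
    ((N * K) * (N * K)) * (P * P)    ≡⟨ regroup₂ N K P ⟩
    ((N * P) * (N * P)) * (K * K)    ≤⟨ *-monoˡ-≤ (K * K) [NP]²≤T ⟩
    T * (K * K)                      ∎))
    where
    open ≤-Reasoning
    regroup₁ : ∀ T e P → T * ((e * P) * (e * P)) ≡ (T * (e * e)) * (P * P)
    regroup₁ = solve-∀
    regroup₂ : ∀ N K P → ((N * K) * (N * K)) * (P * P) ≡ ((N * P) * (N * P)) * (K * K)
    regroup₂ = solve-∀

  ∣correlation∣*poly≤2^n : ∀ {N A} → (∀ m k → StateSplitting N A m k) → ∀ p →
    Eventually (λ n → ℤ.∣ correlation foldedIP A n ∣ * eval p n ≤ 2 ^ n)
  ∣correlation∣*poly≤2^n {N} {A} splits p with poly²≤2^⌊n/2⌋ N p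
  ... | M , bounded = M , λ n M≤n →
    ≤-from-weighted-squares (2 ^ ⌊ n /2⌋) ℤ.∣ correlation foldedIP A n ∣ N (2 ^ n) (eval p n) {{m^n≢0 2 ⌊ n /2⌋}}
      (foldedIP-correlation-bound splits n) (bounded n M≤n)

  foldedIP-pseudorandom : Pseudorandom REG/n foldedIP
  foldedIP-pseudorandom A A∈REG/n p with REG/n⇒splitting A∈REG/n
  ... | N , splits with ∣correlation∣*poly≤2^n splits p
  ... | M , bounded = M , λ n M≤n →
    ∣c/K-½∣*P≤1 (symDiffCount foldedIP A n) (2 ^ n) (eval p n) {{m^n≢0 2 n}}
      (subst (λ e → e * eval p n ≤ 2 * 2 ^ n) (sym (∣2*symDiffCount-2^n∣≡∣correlation∣ foldedIP A n))
             (≤-trans (bounded n M≤n) (m≤n*m (2 ^ n) 2)))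

proposition7p5 : Σ (Language Bool) λ L → ContextFree L × Pseudorandom REG/n L
proposition7p5 = foldedIP , foldedIP-contextFree , foldedIP-pseudorandom
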